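{- Let $(\mathcal{M},X,\bot)$ be an accessible concurrent system with $\mathcal M=\mathcal M(\Sigma,I)$. The following are equivalent: (1) $(\mathcal{M},X,\bot)$ is irreducible; (2) for some state $\alpha\in X$ and some letter $a\in\Sigma$, there exists an $a$-rooted linking execution from $\alpha$; (3) for every state $\alpha\in X$ and every letter $a\in\Sigma$, there exists an $a$-rooted linking execution from $\alpha$.
   Context: A trace monoid $\mathcal{M}=\mathcal{M}(\Sigma,I)$ is the monoid presented by $\langle \Sigma \mid ab=ba,\ (a,b)\in I\rangle$ with $\Sigma$ finite and $I\subseteq\Sigma\times\Sigma$ irreflexive symmetric; words over $\Sigma$ are identified with their images in $\mathcal M$. $D=(\Sigma\times\Sigma)\setminus I$; $\mathcal{M}$ is irreducible if the graph $(\Sigma,D)$ is connected. A concurrent system $(\mathcal{M},X,\bot)$: $X$ finite set of states, $\bot\notin X$, a right action of $\mathcal{M}$ on $X\cup\{\bot\}$ ($\alpha\cdot\varepsilon=\alpha$, $(\alpha\cdot x)\cdot y=\alpha\cdot(xy)$) with $\bot\cdot x=\bot$. It is accessible if for all $\alpha,\beta\in X$ some $x\in\mathcal{M}$ has $\alpha\cdot x=\beta$; alive if for all $\alpha\in X$ and $a\in\Sigma$ some $x\in\mathcal{M}$ containing an occurrence of $a$ has $\alpha\cdot x\ne\bot$; irreducible if accessible, alive and $\mathcal{M}$ irreducible. A linking sequence from $\alpha\in X$ is a sequence of letters $a_1,\dots,a_p$ such that, for some indices $1\le j_1<\dots<j_q\le p$: $\alpha\cdot(a_1\cdots a_p)\ne\bot$;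 $(a_{j_k},a_{j_{k+1}})\in D$ for $k=1,\dots,q-1$; and every letter of $\Sigma$ occurs in $(a_{j_1},\dots,a_{j_q})$. It is $a$-rooted if the indices can be chosen with $a_{j_1}=a$. A (an $a$-rooted) linking execution from $\alpha$ is the image in $\mathcal M$ of a (an $a$-rooted) linking sequence from $\alpha$. -}

module Defs where

open import Data.Nat using (ℕ)
open import Data.Fin using (Fin)
open import Data.Bool using (Bool; true; false)
open import Data.Maybe using (Maybe; just; nothing; _>>=_)
open import Data.List using (List; []; _∷_)
open import Data.List.Membership.Propositional using (_∈_)
open import Data.List.Relation.Binary.Sublist.Propositional using (_⊆_)
open import Data.List.Relation.Unary.Linked using (Linked)
open import Data.Product using (Σ; _×_; ∃)
open import Relation.Binary.PropositionalEquality using (_≡_; _≢_)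
open import Relation.Binary.Construct.Closure.ReflexiveTransitive using (Star)

-- A trace monoid M(Σ, I) with Σ = Fin n, I given by its (decidable)
-- characteristic function, required irreflexive and symmetric.
record TraceAlphabet : Set where
  field
    n     : ℕ
    I     : Fin n → Fin n → Bool
    irrefl : ∀ a → I a a ≡ false
    sym    : ∀ a b → I a b ≡ I b a

  D : Fin n → Fin n → Set
  D a b = I a b ≡ false

  -- M is irreducible iff the graph (Σ, D) is connected
  MonoidIrreducible : Set
  MonoidIrreducible = ∀ a b → Star D a b

-- A concurrent system (M, X, ⊥) with X = Fin m and X ∪ {⊥} = Maybe (Fin m),
-- ⊥ = nothing.  A right action of the presented monoid M(Σ,I) on X ∪ {⊥}
-- with ⊥ absorbing is exactly given by the action of each letter, subject
-- to the defining relations ab = ba for (a,b) ∈ I.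
record ConcurrentSystem (T : TraceAlphabet) : Set where
  open TraceAlphabet T
  field
    m    : ℕ
    step : Fin m → Fin n → Maybe (Fin m)
    comm : ∀ (α : Fin m) a b → I a b ≡ true →
           (step α a >>= λ β → step β b) ≡ (step α b >>= λ β → step β a)

  run : Maybe (Fin m) → List (Fin n) → Maybe (Fin m)
  run s []       = s
  run s (a ∷ w)  = run (s >>= λ β → step β a) w

  Accessible : Set
  Accessible = ∀ (α β : Fin m) → ∃ λ (w : List (Fin n)) → run (just α) w ≡ just β

  Alive : Set
  Alive = ∀ (α : Fin m) (a : Fin n) →
          ∃ λ (w : List (Fin n)) → a ∈ w × run (just α) w ≢ nothing

  Irreducible : Set
  Irreducible = Accessible × Alive × MonoidIrreducible

  RootedLinkingSequence : Fin m → Fin n → List (Fin n) → Set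
  RootedLinkingSequence α a w =
    run (just α) w ≢ nothing ×
    Σ (List (Fin n)) λ u →
      (a ∷ u) ⊆ w × Linked D (a ∷ u) × (∀ (c : Fin n) → c ∈ (a ∷ u))

  HasRootedLinkingExecution : Fin m → Fin n → Set
  HasRootedLinkingExecution α a = ∃ λ w → RootedLinkingSequence α a w

-- Going from a rooted linking execution to irreducibility: the linking
-- subsequence is a D-walk through every letter, so (Σ, D) is connected, and
-- every letter occurs in the execution, so prefixing it by a path reaching its
-- start state (accessibility) shows every state is alive. Conversely,
-- connectedness lets one chain D-paths into a single D-walk from a that visits
-- every letter, and liveness lets one realise the letters of that walk, one
-- after the other, by an execution that never reaches ⊥.
module Submission where

open import Defs
open import Level using (Level)
open import Data.Nat using (NonZero; >-nonZero⁻¹)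
open import Data.Fin using (Fin; fromℕ<)
open import Data.Product using (_×_; ∃; ∃₂; _,_)
open import Data.Maybe using (just; nothing)
open import Data.List using (List; []; _∷_; _++_; allFin)
open import Data.List.Membership.Propositional using (_∈_)
open import Data.List.Membership.Propositional.Properties using (∈-allFin; ∈-++⁺ʳ)
open import Data.List.Relation.Unary.Any using (here; there)
open import Data.List.Relation.Binary.Subset.Propositional using () renaming (_⊆_ to _⊆ₛ_)
open import Data.List.Relation.Binary.Sublist.Propositional using (_⊆_; []; from∈)
open import Data.List.Relation.Binary.Sublist.Propositional.Properties using (++⁺; Any-resp-⊆)
open import Data.List.Relation.Unary.Linked using (Linked; [-]; _∷_)
open import Data.Empty using (⊥-elim)
open import Function.Bundles using (_⇔_; mk⇔)
open import Relation.Binary.Core using (Rel)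
open import Relation.Binary.Definitions using (Symmetric)
open import Relation.Binary.PropositionalEquality using (_≡_; _≢_; refl; sym; trans; cong)
open import Relation.Binary.Construct.Closure.ReflexiveTransitive using (Star; ε; _◅_; _◅◅_; reverse)

module _ {a ℓ : Level} {A : Set a} {R : Rel A ℓ} where

  Linked⇒Star-head : ∀ {x c u} → Linked R (x ∷ u) → c ∈ x ∷ u → Star R x c
  Linked⇒Star-head _       (here refl) = ε
  Linked⇒Star-head (r ∷ l) (there c∈u) = r ◅ Linked⇒Star-head l c∈u

  Star-prepend-Linked : ∀ {x y u} → Star R x y → Linked R (y ∷ u) →
                        ∃ λ v → Linked R (x ∷ v) × (y ∷ u) ⊆ₛ (x ∷ v)
  Star-prepend-Linked {u = u} ε l = u , l , λ c∈ → c∈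
  Star-prepend-Linked (r ◅ p) l with Star-prepend-Linked p l
  ... | v , l′ , incl = _ ∷ v , r ∷ l′ , λ c∈ → there (incl c∈)

  connected⇒Linked-cover : (∀ x y → Star R x y) → ∀ (bs : List A) x →
                           ∃ λ u → Linked R (x ∷ u) × bs ⊆ₛ (x ∷ u)
  connected⇒Linked-cover conn []       x = [] , [-] , λ ()
  connected⇒Linked-cover conn (b ∷ bs) x with connected⇒Linked-cover conn bs b
  ... | u , l , bs⊆ with Star-prepend-Linked (conn x b) l
  ... | v , l′ , b∷u⊆ = v , l′ , cover
    where
    cover : (b ∷ bs) ⊆ₛ (x ∷ v)
    cover (here refl)  = b∷u⊆ (here refl)
    cover (there c∈bs) = b∷u⊆ (bs⊆ c∈bs)

  Linked-cover⇒connected : Symmetric R → ∀ {x u} → Linked R (x ∷ u) →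
                           (∀ c → c ∈ x ∷ u) → ∀ b c → Star R b c
  Linked-cover⇒connected R-sym l covers b c =
    reverse R-sym (Linked⇒Star-head l (covers b)) ◅◅ Linked⇒Star-head l (covers c)

module _ (T : TraceAlphabet) (S : ConcurrentSystem T) where
  open TraceAlphabet T hiding (sym)
  open ConcurrentSystem S

  D-sym : Symmetric D
  D-sym {x} {y} Dxy = trans (TraceAlphabet.sym T y x) Dxy

  run-++ : ∀ s x w → run s (x ++ w) ≡ run (run s x) w
  run-++ s []      w = refl
  run-++ s (a ∷ x) w = run-++ _ x w

  run-++-via : ∀ {α β} x w → run (just α) x ≡ just β →
               run (just α) (x ++ w) ≡ run (just β) w
  run-++-via {α} x w reaches = trans (run-++ (just α) x w) (cong (λ s → run s w) reaches)

  Alive⇒live-supersequence : Alive → ∀ (V : List (Fin n)) α →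
                             ∃ λ w → V ⊆ w × run (just α) w ≢ nothing
  Alive⇒live-supersequence alive []      α = [] , [] , λ ()
  Alive⇒live-supersequence alive (c ∷ V) α with alive α c
  ... | x , c∈x , x-live with run (just α) x in reaches
  ... | nothing = ⊥-elim (x-live refl)
  ... | just β with Alive⇒live-supersequence alive V β
  ... | w , V⊆w , w-live =
    x ++ w , ++⁺ (from∈ c∈x) V⊆w , λ dead → w-live (trans (sym (run-++-via x w reaches)) dead)

  Irreducible⇒rooted-linking : Irreducible → ∀ α a → HasRootedLinkingExecution α a
  Irreducible⇒rooted-linking (_ , alive , connected) α a
    with connected⇒Linked-cover connected (allFin n) a
  ... | u , linked , covers with Alive⇒live-supersequence alive (a ∷ u) α
  ... | w , a∷u⊆w , w-live = w , w-live , u , a∷u⊆w , linked , λ c → covers (∈-allFin c)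

  rooted-linking⇒Irreducible : Accessible → ∀ {α a} → HasRootedLinkingExecution α a →
                               Irreducible
  rooted-linking⇒Irreducible accessible {α} (w , w-live , u , a∷u⊆w , linked , covers) =
    accessible , alive , Linked-cover⇒connected D-sym linked covers
    where
    alive : Alive
    alive β c with accessible β α
    ... | v , v-reaches =
      v ++ w , ∈-++⁺ʳ v (Any-resp-⊆ a∷u⊆w (covers c)) ,
      λ dead → w-live (trans (sym (run-++-via v w v-reaches)) dead)

proposition9 : (T : TraceAlphabet) (S : ConcurrentSystem T) →
    let open TraceAlphabet T
        open ConcurrentSystem S
    in NonZero n → NonZero m → Accessible →
       (Irreducible ⇔ (∃₂ λ (α : Fin m) (a : Fin n) → HasRootedLinkingExecution α a))
       × (Irreducible ⇔ (∀ (α : Fin m) (a : Fin n) → HasRootedLinkingExecution α a))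
proposition9 T S n≢0 m≢0 accessible =
  mk⇔ (λ irr → α₀ , a₀ , Irreducible⇒rooted-linking T S irr α₀ a₀)
      (λ { (_ , _ , exec) → rooted-linking⇒Irreducible T S accessible exec }) ,
  mk⇔ (Irreducible⇒rooted-linking T S)
      (λ execs → rooted-linking⇒Irreducible T S accessible (execs α₀ a₀))
  where
  open TraceAlphabet T using (n)
  open ConcurrentSystem S using (m)
  α₀ : Fin m
  α₀ = fromℕ< (>-nonZero⁻¹ m {{m≢0}})
  a₀ : Fin n
  a₀ = fromℕ< (>-nonZero⁻¹ n {{n≢0}})
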